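{- Let $G$ be a finite bipartite graph which is disconnected, and suppose that one of its connected components $P$ satisfies Frankl's conjecture. Then $G$ satisfies Frankl's conjecture.
   Context: A stable set of a graph is a set of pairwise non-adjacent vertices; it is maximal if no further vertex can be added while keeping it stable. A vertex $x$ of a finite graph $G$ is rare in $G$ if $x$ lies in at most half of the maximal stable sets of $G$. A bipartite graph $G$ satisfies Frankl's conjecture if for every bipartition $(X,Y)$ of $V(G)$ into two stable sets, each of $X$ and $Y$ contains a vertex that is rare in $G$ (for a connected component $P$ this refers to the maximal stable sets of $P$ and the bipartition of $P$). -}

module Defs where

open import Data.Nat using (ℕ; zero; suc; _+_; _*_; _≤_)
open import Data.Bool using (Bool; true; false; if_then_else_)
open import Data.Bool.Properties using () renaming (_≟_ to _≟ᵇ_)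
open import Data.Fin using (Fin)
open import Data.Fin.Properties using (all?; any?)
open import Data.Fin.Subset
  using (Subset; _∈_; _∉_; _⊆_; _∪_; _∩_; ⁅_⁆; ⊥; ⊤; inside; outside)
open import Data.Fin.Subset.Properties using (_∈?_; _⊆?_)
open import Data.Vec using ([]; _∷_)
open import Data.Product using (Σ; ∃; ∃-syntax; _×_; _,_)
open import Relation.Nullary using (¬_; Dec; yes; no; does)
open import Relation.Nullary.Decidable using (_×-dec_; _→-dec_; ¬?)
open import Relation.Binary.PropositionalEquality using (_≡_)

record Graph : Set where
  field
    n     : ℕ
    adj   : Fin n → Fin n → Bool
    sym   : ∀ x y → adj x y ≡ adj y x
    irrefl : ∀ x → adj x x ≡ false

open Graph public

countSubsets : ∀ {n} (P : Subset n → Set) → (∀ s → Dec (P s)) → ℕ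
countSubsets {zero}  P P? = if does (P? []) then 1 else 0
countSubsets {suc n} P P? =
  countSubsets (λ s → P (inside ∷ s))  (λ s → P? (inside ∷ s)) +
  countSubsets (λ s → P (outside ∷ s)) (λ s → P? (outside ∷ s))

-- Everything is relative to a vertex set S ⊆ V(G), i.e. to the induced
-- subgraph G[S].  G itself is G[⊤].

module _ (G : Graph) where

  Stable : Subset (n G) → Subset (n G) → Set
  Stable S T = T ⊆ S × (∀ x y → x ∈ T → y ∈ T → adj G x y ≡ false)

  MaxStable : Subset (n G) → Subset (n G) → Set
  MaxStable S T = Stable S T × (∀ x → x ∈ S → x ∉ T → ¬ Stable S (T ∪ ⁅ x ⁆))

  stable? : ∀ S T → Dec (Stable S T)
  stable? S T = (T ⊆? S) ×-dec
    all? (λ x → all? (λ y → (x ∈? T) →-dec ((y ∈? T) →-dec (adj G x y ≟ᵇ false))))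

  maxStable? : ∀ S T → Dec (MaxStable S T)
  maxStable? S T = stable? S T ×-dec
    all? (λ x → (x ∈? S) →-dec ((¬? (x ∈? T)) →-dec ¬? (stable? S (T ∪ ⁅ x ⁆))))

  #maxStable : Subset (n G) → ℕ
  #maxStable S = countSubsets (MaxStable S) (maxStable? S)

  #maxStableContaining : Subset (n G) → Fin (n G) → ℕ
  #maxStableContaining S x =
    countSubsets (λ T → MaxStable S T × x ∈ T) (λ T → maxStable? S T ×-dec (x ∈? T))

  Rare : Subset (n G) → Fin (n G) → Set
  Rare S x = x ∈ S × 2 * #maxStableContaining S x ≤ #maxStable S

  Bipartition : Subset (n G) → Subset (n G) → Subset (n G) → Set
  Bipartition S X Y = X ∪ Y ≡ S × X ∩ Y ≡ ⊥ × Stable S X × Stable S Y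

  Bipartite : Subset (n G) → Set
  Bipartite S = ∃[ X ] ∃[ Y ] Bipartition S X Y

  SatisfiesFrankl : Subset (n G) → Set
  SatisfiesFrankl S = ∀ X Y → Bipartition S X Y →
    (∃[ x ] (x ∈ X × Rare S x)) × (∃[ y ] (y ∈ Y × Rare S y))

  data Reach (S : Subset (n G)) : Fin (n G) → Fin (n G) → Set where
    here : ∀ {u} → u ∈ S → Reach S u u
    step : ∀ {u w v} → u ∈ S → adj G u w ≡ true → Reach S w v → Reach S u v

  -- G is connected (no vertices => connected) / disconnected
  Connected : Set
  Connected = ∀ u v → Reach ⊤ u v

  Disconnected : Set
  Disconnected = ¬ Connected

  IsComponent : Subset (n G) → Set
  IsComponent P = (∃[ u ] u ∈ P)
                × (∀ u v → u ∈ P → v ∈ P → Reach P u v)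
                × (∀ u v → u ∈ P → adj G u v ≡ true → v ∈ P)

-- Since P is closed under adjacency, there are no edges between P and its
-- complement Q.  Hence a set is maximal stable in G exactly when its traces
-- on P and on Q are maximal stable in G[P] and G[Q], so for x ∈ P both the
-- number of maximal stable sets of G and the number of those containing x
-- arise from the corresponding numbers for G[P] by multiplying with the
-- number of maximal stable sets of G[Q].  Rarity in G[P] therefore implies
-- rarity in G, and a bipartition of G traces to a bipartition of G[P].

module Submission where

open import Defs hiding (sym)
open import Data.Bool using (true; false)
open import Data.Empty using (⊥-elim)
open import Data.Fin using (Fin; zero; suc)
open import Data.Fin.Subset
open import Data.Fin.Subset.Properties
open import Data.Nat using (ℕ; zero; suc; _+_; _*_)
open import Data.Nat.Properties using (*-assoc; *-monoˡ-≤; *-distribʳ-+; *-distribˡ-+; module ≤-Reasoning)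
open import Data.Product using (∃-syntax; _×_; _,_; proj₁; proj₂)
open import Data.Unit using (tt) renaming (⊤ to Unit)
open import Data.Vec using ([]; _∷_; here; there)
open import Function using (_∘_)
open import Relation.Nullary using (¬_; Dec; yes; no)
open import Relation.Nullary.Decidable using (_×-dec_)
open import Relation.Binary.PropositionalEquality

countSubsets-cong : ∀ {n} {A B : Subset n → Set} (A? : ∀ s → Dec (A s)) (B? : ∀ s → Dec (B s)) →
  (∀ s → A s → B s) → (∀ s → B s → A s) → countSubsets A A? ≡ countSubsets B B?
countSubsets-cong {zero} A? B? f g with A? [] | B? []
... | yes _ | yes _ = refl
... | yes a | no ¬b = ⊥-elim (¬b (f [] a))
... | no ¬a | yes b = ⊥-elim (¬a (g [] b))
... | no _  | no _  = refl
countSubsets-cong {suc n} A? B? f g =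
  cong₂ _+_ (countSubsets-cong {n} _ _ (λ s → f _) (λ s → g _))
            (countSubsets-cong {n} _ _ (λ s → f _) (λ s → g _))

countSubsets-empty : ∀ {n} {A : Subset n → Set} (A? : ∀ s → Dec (A s)) →
  (∀ s → ¬ A s) → countSubsets A A? ≡ 0
countSubsets-empty {zero} A? ¬A with A? []
... | yes a = ⊥-elim (¬A [] a)
... | no _  = refl
countSubsets-empty {suc n} A? ¬A =
  cong₂ _+_ (countSubsets-empty {n} _ (λ s → ¬A _)) (countSubsets-empty {n} _ (λ s → ¬A _))

countSubsetsOf : ∀ {n} (P : Subset n) (A : Subset n → Set) → (∀ s → Dec (A s)) → ℕ
countSubsetsOf P A A? = countSubsets (λ S → S ⊆ P × A S) (λ S → (S ⊆? P) ×-dec A? S)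

module _ {n} (P : Subset n) (A : Subset (suc n) → Set) (A? : ∀ s → Dec (A s)) where

  countSubsetsOf-inside : countSubsetsOf (inside ∷ P) A A? ≡
    countSubsetsOf P (λ S → A (inside ∷ S)) (λ S → A? (inside ∷ S)) +
    countSubsetsOf P (λ S → A (outside ∷ S)) (λ S → A? (outside ∷ S))
  countSubsetsOf-inside =
    cong₂ _+_ (countSubsets-cong {n} _ _ (λ _ (p , a) → drop-∷-⊆ p , a) (λ _ (p , a) → in⊆in p , a))
              (countSubsets-cong {n} _ _ (λ _ (p , a) → drop-∷-⊆ p , a) (λ _ (p , a) → out⊆ p , a))

  countSubsetsOf-outside : countSubsetsOf (outside ∷ P) A A? ≡
    countSubsetsOf P (λ S → A (outside ∷ S)) (λ S → A? (outside ∷ S))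
  countSubsetsOf-outside =
    cong₂ _+_ (countSubsets-empty {n} _ (λ _ (p , _) → inside∉outside (p here)))
              (countSubsets-cong {n} _ _ (λ _ (p , a) → drop-∷-⊆ p , a) (λ _ (p , a) → out⊆ p , a))
    where
    inside∉outside : ∀ {m} {q : Subset m} → ¬ (zero ∈ outside ∷ q)
    inside∉outside ()

countSubsetsOf-⊇ : ∀ {n} (P : Subset n) {A : Subset n → Set} (A? : ∀ s → Dec (A s)) →
  (∀ s → A s → s ⊆ P) → countSubsetsOf P A A? ≡ countSubsets A A?
countSubsetsOf-⊇ P A? A⊆P = countSubsets-cong _ _ (λ _ → proj₂) (λ s a → A⊆P s a , a)

-- Choosing T amounts to choosing T ∩ P ⊆ P and T ∩ ∁ P ⊆ ∁ P independently.
countSubsets-split : ∀ {n} (P : Subset n) (A B : Subset n → Set)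
  (A? : ∀ s → Dec (A s)) (B? : ∀ s → Dec (B s)) →
  countSubsets (λ T → A (T ∩ P) × B (T ∩ ∁ P)) (λ T → A? (T ∩ P) ×-dec B? (T ∩ ∁ P))
  ≡ countSubsetsOf P A A? * countSubsetsOf (∁ P) B B?
countSubsets-split {zero} [] A B A? B? with A? [] | B? []
... | yes _ | yes _ = refl
... | yes _ | no _  = refl
... | no _  | yes _ = refl
... | no _  | no _  = refl
countSubsets-split {suc n} (inside ∷ P) A B A? B? = begin
  countSubsets (λ T → A (T ∩ (inside ∷ P)) × B (T ∩ ∁ (inside ∷ P)))
               (λ T → A? (T ∩ (inside ∷ P)) ×-dec B? (T ∩ ∁ (inside ∷ P)))
                                ≡⟨ cong₂ _+_ (countSubsets-split P _ _ _ _) (countSubsets-split P _ _ _ _) ⟩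
  a₁ * b₀ + a₀ * b₀             ≡⟨ *-distribʳ-+ b₀ a₁ a₀ ⟨
  (a₁ + a₀) * b₀                ≡⟨ cong₂ _*_ (countSubsetsOf-inside P A A?) (countSubsetsOf-outside (∁ P) B B?) ⟨
  countSubsetsOf (inside ∷ P) A A? * countSubsetsOf (∁ (inside ∷ P)) B B? ∎
  where
  open ≡-Reasoning
  a₁ = countSubsetsOf P (λ S → A (inside ∷ S)) (λ S → A? (inside ∷ S))
  a₀ = countSubsetsOf P (λ S → A (outside ∷ S)) (λ S → A? (outside ∷ S))
  b₀ = countSubsetsOf (∁ P) (λ S → B (outside ∷ S)) (λ S → B? (outside ∷ S))
countSubsets-split {suc n} (outside ∷ P) A B A? B? = begin
  countSubsets (λ T → A (T ∩ (outside ∷ P)) × B (T ∩ ∁ (outside ∷ P)))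
               (λ T → A? (T ∩ (outside ∷ P)) ×-dec B? (T ∩ ∁ (outside ∷ P)))
                                ≡⟨ cong₂ _+_ (countSubsets-split P _ _ _ _) (countSubsets-split P _ _ _ _) ⟩
  a₀ * b₁ + a₀ * b₀             ≡⟨ *-distribˡ-+ a₀ b₁ b₀ ⟨
  a₀ * (b₁ + b₀)                ≡⟨ cong₂ _*_ (countSubsetsOf-outside P A A?) (countSubsetsOf-inside (∁ P) B B?) ⟨
  countSubsetsOf (outside ∷ P) A A? * countSubsetsOf (∁ (outside ∷ P)) B B? ∎
  where
  open ≡-Reasoning
  a₀ = countSubsetsOf P (λ S → A (outside ∷ S)) (λ S → A? (outside ∷ S))
  b₁ = countSubsetsOf (∁ P) (λ S → B (inside ∷ S)) (λ S → B? (inside ∷ S))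
  b₀ = countSubsetsOf (∁ P) (λ S → B (outside ∷ S)) (λ S → B? (outside ∷ S))

⁅x⁆∩p≡⁅x⁆ : ∀ {n} {x : Fin n} {p : Subset n} → x ∈ p → ⁅ x ⁆ ∩ p ≡ ⁅ x ⁆
⁅x⁆∩p≡⁅x⁆ {p = _ ∷ p} here      = cong (inside ∷_) (∩-zeroˡ p)
⁅x⁆∩p≡⁅x⁆               (there m) = cong (outside ∷_) (⁅x⁆∩p≡⁅x⁆ m)

⁅x⁆∩p≡⊥ : ∀ {n} {x : Fin n} {p : Subset n} → x ∉ p → ⁅ x ⁆ ∩ p ≡ ⊥
⁅x⁆∩p≡⊥ {x = zero}  {outside ∷ p} _   = cong (outside ∷_) (∩-zeroˡ p)
⁅x⁆∩p≡⊥ {x = zero}  {inside ∷ p}  x∉p = ⊥-elim (x∉p here)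
⁅x⁆∩p≡⊥ {x = suc x} {_ ∷ p}       x∉p = cong (outside ∷_) (⁅x⁆∩p≡⊥ (λ m → x∉p (there m)))

∪⁅x⁆-∩-∈ : ∀ {n} {x : Fin n} (T : Subset n) {S : Subset n} → x ∈ S → (T ∪ ⁅ x ⁆) ∩ S ≡ (T ∩ S) ∪ ⁅ x ⁆
∪⁅x⁆-∩-∈ {x = x} T {S} x∈S =
  trans (∩-distribʳ-∪ S T ⁅ x ⁆) (cong ((T ∩ S) ∪_) (⁅x⁆∩p≡⁅x⁆ x∈S))

∪⁅x⁆-∩-∉ : ∀ {n} {x : Fin n} (T : Subset n) {S : Subset n} → x ∉ S → (T ∪ ⁅ x ⁆) ∩ S ≡ T ∩ S
∪⁅x⁆-∩-∉ {x = x} T {S} x∉S =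
  trans (∩-distribʳ-∪ S T ⁅ x ⁆) (trans (cong ((T ∩ S) ∪_) (⁅x⁆∩p≡⊥ x∉S)) (∪-identityʳ (T ∩ S)))

module _ (G : Graph) where

  Separated : Subset (n G) → Set
  Separated P = ∀ u v → u ∈ P → v ∉ P → adj G u v ≡ false

  closed⇒separated : ∀ P → (∀ u v → u ∈ P → adj G u v ≡ true → v ∈ P) → Separated P
  closed⇒separated P closed u v u∈P v∉P with adj G u v in e
  ... | true  = ⊥-elim (v∉P (closed u v u∈P e))
  ... | false = refl

  separated-∁ : ∀ {P} → Separated P → Separated (∁ P)
  separated-∁ sep u v u∈∁P v∉∁P =
    trans (Graph.sym G u v) (sep v u (x∉∁p⇒x∈p v∉∁P) (x∈∁p⇒x∉p u∈∁P))

  stable-∩ : ∀ S {T} → Stable G ⊤ T → Stable G S (T ∩ S)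
  stable-∩ S {T} (_ , indep) = p∩q⊆q T S , λ x y x∈ y∈ →
    indep x y (p∩q⊆p T S x∈) (p∩q⊆p T S y∈)

  stable-join : ∀ {P} T → Separated P →
    Stable G P (T ∩ P) → Stable G (∁ P) (T ∩ ∁ P) → Stable G ⊤ T
  stable-join {P} T sep (_ , indepP) (_ , indepQ) = ⊆⊤ , indep
    where
    indep : ∀ x y → x ∈ T → y ∈ T → adj G x y ≡ false
    indep x y x∈T y∈T with x ∈? P | y ∈? P
    ... | yes x∈P | yes y∈P = indepP x y (x∈p∩q⁺ (x∈T , x∈P)) (x∈p∩q⁺ (y∈T , y∈P))
    ... | yes x∈P | no  y∉P = sep x y x∈P y∉P
    ... | no  x∉P | yes y∈P = trans (Graph.sym G x y) (sep y x y∈P x∉P)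
    ... | no  x∉P | no  y∉P =
      indepQ x y (x∈p∩q⁺ (x∈T , x∉p⇒x∈∁p x∉P)) (x∈p∩q⁺ (y∈T , x∉p⇒x∈∁p y∉P))

  maxStable-∩ : ∀ {S T} → Separated S → MaxStable G ⊤ T → MaxStable G S (T ∩ S)
  maxStable-∩ {S} {T} sep (stableT , maximal) = stable-∩ S stableT , extend
    where
    extend : ∀ x → x ∈ S → x ∉ T ∩ S → ¬ Stable G S ((T ∩ S) ∪ ⁅ x ⁆)
    extend x x∈S x∉T∩S stable = maximal x ∈⊤ (λ x∈T → x∉T∩S (x∈p∩q⁺ (x∈T , x∈S)))
      (stable-join (T ∪ ⁅ x ⁆) sep
        (subst (Stable G S) (sym (∪⁅x⁆-∩-∈ T x∈S)) stable)
        (subst (Stable G (∁ S)) (sym (∪⁅x⁆-∩-∉ T (x∈p⇒x∉∁p x∈S))) (stable-∩ (∁ S) stableT)))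

  maxStable-join : ∀ {P} T → Separated P →
    MaxStable G P (T ∩ P) → MaxStable G (∁ P) (T ∩ ∁ P) → MaxStable G ⊤ T
  maxStable-join {P} T sep (stableP , maximalP) (stableQ , maximalQ) =
    stable-join T sep stableP stableQ , extend
    where
    extend : ∀ x → x ∈ ⊤ → x ∉ T → ¬ Stable G ⊤ (T ∪ ⁅ x ⁆)
    extend x _ x∉T stable with x ∈? P
    ... | yes x∈P = maximalP x x∈P (λ m → x∉T (p∩q⊆p T P m))
      (subst (Stable G P) (∪⁅x⁆-∩-∈ T x∈P) (stable-∩ P stable))
    ... | no x∉P = maximalQ x (x∉p⇒x∈∁p x∉P) (λ m → x∉T (p∩q⊆p T (∁ P) m))
      (subst (Stable G (∁ P)) (∪⁅x⁆-∩-∈ T (x∉p⇒x∈∁p x∉P)) (stable-∩ (∁ P) stable))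

  countMaxStable-split : ∀ {P} → Separated P →
    (C : Subset (n G) → Set) (C? : ∀ T → Dec (C T)) →
    (∀ T → C T → C (T ∩ P)) → (∀ T → C (T ∩ P) → C T) →
    countSubsets (λ T → MaxStable G ⊤ T × C T) (λ T → maxStable? G ⊤ T ×-dec C? T)
    ≡ countSubsets (λ S → MaxStable G P S × C S) (λ S → maxStable? G P S ×-dec C? S)
      * #maxStable G (∁ P)
  countMaxStable-split {P} sep C C? C⇒C∩ C∩⇒C = begin
    countSubsets (λ T → MaxStable G ⊤ T × C T) _
      ≡⟨ countSubsets-cong _ traces?
           (λ T (max , c) → (maxStable-∩ sep max , C⇒C∩ T c) , maxStable-∩ (separated-∁ sep) max)
           (λ T ((maxP , c) , maxQ) → maxStable-join T sep maxP maxQ , C∩⇒C T c) ⟩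
    countSubsets (λ T → (MaxStable G P (T ∩ P) × C (T ∩ P)) × MaxStable G (∁ P) (T ∩ ∁ P)) traces?
      ≡⟨ countSubsets-split P _ _ _ _ ⟩
    countSubsetsOf P (λ S → MaxStable G P S × C S) _ * countSubsetsOf (∁ P) (MaxStable G (∁ P)) _
      ≡⟨ cong₂ _*_ (countSubsetsOf-⊇ P _ (λ _ → proj₁ ∘ proj₁ ∘ proj₁))
                   (countSubsetsOf-⊇ (∁ P) _ (λ _ → proj₁ ∘ proj₁)) ⟩
    countSubsets (λ S → MaxStable G P S × C S) _ * #maxStable G (∁ P) ∎
    where
    open ≡-Reasoning
    traces? : ∀ T → Dec ((MaxStable G P (T ∩ P) × C (T ∩ P)) × MaxStable G (∁ P) (T ∩ ∁ P))
    traces? T = (maxStable? G P (T ∩ P) ×-dec C? (T ∩ P)) ×-dec maxStable? G (∁ P) (T ∩ ∁ P)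

  #maxStable-split : ∀ {P} → Separated P → #maxStable G ⊤ ≡ #maxStable G P * #maxStable G (∁ P)
  #maxStable-split {P} sep = begin
    #maxStable G ⊤
      ≡⟨ countSubsets-cong (maxStable? G ⊤) _ (λ _ m → m , tt) (λ _ → proj₁) ⟩
    countSubsets (λ T → MaxStable G ⊤ T × Unit) (λ T → maxStable? G ⊤ T ×-dec yes tt)
      ≡⟨ countMaxStable-split sep (λ _ → Unit) (λ _ → yes tt) (λ _ _ → tt) (λ _ _ → tt) ⟩
    countSubsets (λ S → MaxStable G P S × Unit) (λ S → maxStable? G P S ×-dec yes tt) * #maxStable G (∁ P)
      ≡⟨ cong (_* #maxStable G (∁ P)) (countSubsets-cong _ (maxStable? G P) (λ _ → proj₁) (λ _ m → m , tt)) ⟩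
    #maxStable G P * #maxStable G (∁ P) ∎
    where open ≡-Reasoning

  #maxStableContaining-split : ∀ {P x} → Separated P → x ∈ P →
    #maxStableContaining G ⊤ x ≡ #maxStableContaining G P x * #maxStable G (∁ P)
  #maxStableContaining-split {P} {x} sep x∈P = countMaxStable-split sep (x ∈_) (x ∈?_)
    (λ T x∈T → x∈p∩q⁺ (x∈T , x∈P)) (λ T → p∩q⊆p T P)

  rare-⊤ : ∀ {P x} → Separated P → Rare G P x → Rare G ⊤ x
  rare-⊤ {P} {x} sep (x∈P , rareP) = ∈⊤ , (begin
    2 * #maxStableContaining G ⊤ x
      ≡⟨ cong (2 *_) (#maxStableContaining-split sep x∈P) ⟩
    2 * (#maxStableContaining G P x * #maxStable G (∁ P))
      ≡⟨ *-assoc 2 (#maxStableContaining G P x) (#maxStable G (∁ P)) ⟨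
    2 * #maxStableContaining G P x * #maxStable G (∁ P)
      ≤⟨ *-monoˡ-≤ (#maxStable G (∁ P)) rareP ⟩
    #maxStable G P * #maxStable G (∁ P)
      ≡⟨ #maxStable-split sep ⟨
    #maxStable G ⊤ ∎)
    where open ≤-Reasoning

  bipartition-∩ : ∀ P {X Y} → Bipartition G ⊤ X Y → Bipartition G P (X ∩ P) (Y ∩ P)
  bipartition-∩ P {X} {Y} (X∪Y≡⊤ , X∩Y≡⊥ , stableX , stableY) =
    covers , disjoint , stable-∩ P stableX , stable-∩ P stableY
    where
    covers : (X ∩ P) ∪ (Y ∩ P) ≡ P
    covers = begin
      (X ∩ P) ∪ (Y ∩ P) ≡⟨ ∩-distribʳ-∪ P X Y ⟨
      (X ∪ Y) ∩ P       ≡⟨ cong (_∩ P) X∪Y≡⊤ ⟩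
      ⊤ ∩ P             ≡⟨ ∩-identityˡ P ⟩
      P                 ∎
      where open ≡-Reasoning
    disjoint : (X ∩ P) ∩ (Y ∩ P) ≡ ⊥
    disjoint = ⊆-antisym
      (λ m → subst (_ ∈_) X∩Y≡⊥ (x∈p∩q⁺ (p∩q⊆p X P (p∩q⊆p _ _ m) , p∩q⊆p Y P (p∩q⊆q _ _ m))))
      ⊥⊆

proposition3p1 : (G : Graph) → Bipartite G ⊤ → Disconnected G →
    (P : Subset (Graph.n G)) → IsComponent G P → SatisfiesFrankl G P →
    SatisfiesFrankl G ⊤
proposition3p1 G _ _ P (_ , _ , closed) franklP X Y bipartition =
  lift X (proj₁ rareInP) , lift Y (proj₂ rareInP)
  where
  rareInP = franklP (X ∩ P) (Y ∩ P) (bipartition-∩ G P bipartition)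
  lift : ∀ Z → ∃[ z ] (z ∈ Z ∩ P × Rare G P z) → ∃[ z ] (z ∈ Z × Rare G ⊤ z)
  lift Z (z , z∈Z∩P , rare) = z , p∩q⊆p Z P z∈Z∩P , rare-⊤ G (closed⇒separated G P closed) rare
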